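{- Let $s\ge 3$. Then $$m_2(s)\le \max\left\{\min_{i\in\{1,2\}}\prod_{j=0}^{s-3}\left\lceil\frac{(n_i-2)-j}{s-2}\right\rceil\right\},$$ where the maximum is taken over all pairs $n_1,n_2\in\mathbb{N}$ satisfying: (1) $n_1,n_2\ge s$; (2) $n_1+n_2\le R_2(s)+2$; (3) $|n_1-n_2|<R(s-1,s)-(s-2)$.
   Context: $R(a,b)$ denotes the two-color Ramsey number: the least $n$ such that every coloring of the edges of the complete graph $K_n$ with colors $1,2$ contains a $K_a$ all of whose edges have color $1$ or a $K_b$ all of whose edges have color $2$; $R_2(s)=R(s,s)$. The critical multiplicity $m_2(s)=m(s,s)$ is the smallest number of monochromatic subgraphs isomorphic to $K_s$ (in either color) that occur in a 2-coloring of the edges of $K_{R(s,s)}$, i.e. the largest $M$ such that every 2-coloring of the edges of $K_{R(s,s)}$ contains at least $M$ monochromatic copies of $K_s$. -}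

module Defs where

open import Data.Bool using (Bool; true; false)
open import Data.Bool.Properties using () renaming (_≟_ to _≟ᵇ_)
open import Data.Nat using (ℕ; zero; suc; _+_; _*_; _∸_; _≤_; _<_; _⊔_; _⊓_; ∣_-_∣; _/_)
open import Data.Nat.Properties using (_≟_; _≤?_; _<?_)
open import Data.Fin using (Fin)
open import Data.Fin.Properties using (all?) renaming (_≟_ to _≟ᶠ_)
open import Data.Fin.Subset using (Subset; _∈_; ∣_∣; inside; outside)
open import Data.Fin.Subset.Properties using (_∈?_)
open import Data.Vec using ([]; _∷_)
open import Data.List using (List; []; _∷_; [_]; map; _++_; filter; length; upTo; foldr; concatMap)
open import Data.Nat.ListAction using (product)
open import Data.Product using (Σ; ∃; _×_; _,_)
open import Data.Sum using (_⊎_)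
open import Relation.Binary.PropositionalEquality using (_≡_; _≢_)
open import Relation.Nullary using (Dec; ¬_)
open import Relation.Nullary.Decidable using (_×-dec_; _⊎-dec_; _→-dec_; ¬?)

-- A 2-colouring of the edges of K_n: a symmetric colour function on vertex pairs
-- (values on the diagonal are irrelevant). Colour 1 = true, colour 2 = false.
record Coloring (n : ℕ) : Set where
  field
    col : Fin n → Fin n → Bool
    sym : ∀ i j → col i j ≡ col j i
open Coloring public

Mono : ∀ {n} → Coloring n → Bool → Subset n → Set
Mono c b p = ∀ i j → i ∈ p → j ∈ p → i ≢ j → col c i j ≡ b

mono? : ∀ {n} (c : Coloring n) (b : Bool) (p : Subset n) → Dec (Mono c b p)
mono? c b p = all? λ i → all? λ j →
  (i ∈? p) →-dec ((j ∈? p) →-dec ((¬? (i ≟ᶠ j)) →-dec (col c i j ≟ᵇ b)))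

HasMonoClique : ∀ {n} → Coloring n → Bool → ℕ → Set
HasMonoClique c b a = Σ (Subset _) λ p → ∣ p ∣ ≡ a × Mono c b p

Arrows : ℕ → ℕ → ℕ → Set
Arrows a b n = (c : Coloring n) → HasMonoClique c true a ⊎ HasMonoClique c false b

IsRamsey : ℕ → ℕ → ℕ → Set
IsRamsey a b n = Arrows a b n × (∀ m → Arrows a b m → n ≤ m)

allSubsets : (n : ℕ) → List (Subset n)
allSubsets zero = [ [] ]
allSubsets (suc n) = map (inside ∷_) (allSubsets n) ++ map (outside ∷_) (allSubsets n)

monoCount : ∀ {n} → ℕ → Coloring n → ℕ
monoCount {n} s c =
  length (filter (λ p → (∣ p ∣ ≟ s) ×-dec (mono? c true p ⊎-dec mono? c false p)) (allSubsets n))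

IsMinMonoCount : ℕ → ℕ → ℕ → Set
IsMinMonoCount s N M = (∀ (c : Coloring N) → M ≤ monoCount s c) × (∃ λ (c : Coloring N) → monoCount s c ≡ M)

IsCriticalMultiplicity : ℕ → ℕ → Set
IsCriticalMultiplicity s M = ∃ λ N → IsRamsey s s N × IsMinMonoCount s N M

ceilDiv : ℕ → ℕ → ℕ
ceilDiv a zero = 0
ceilDiv a (suc k) = (a + k) / suc k

prodTerm : ℕ → ℕ → ℕ
prodTerm s n = product (map (λ j → ceilDiv ((n ∸ 2) ∸ j) (s ∸ 2)) (upTo (s ∸ 2)))

-- conditions (1)-(3) on the pair (n₁,n₂), with R2 = R(s,s), R' = R(s-1,s)
Admissible : ℕ → ℕ → ℕ → ℕ → ℕ → Set
Admissible s R2 R' n₁ n₂ =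
  s ≤ n₁ × s ≤ n₂ × n₁ + n₂ ≤ R2 + 2 × ∣ n₁ - n₂ ∣ < R' ∸ (s ∸ 2)

admissible? : ∀ s R2 R' n₁ n₂ → Dec (Admissible s R2 R' n₁ n₂)
admissible? s R2 R' n₁ n₂ =
  (s ≤? n₁) ×-dec (s ≤? n₂) ×-dec (n₁ + n₂ ≤? R2 + 2) ×-dec (∣ n₁ - n₂ ∣ <? R' ∸ (s ∸ 2))

-- all pairs (n₁,n₂) with n₁,n₂ ≤ R2 + 2 (condition (2) forces this range)
candidatePairs : ℕ → List (ℕ × ℕ)
candidatePairs R2 = concatMap (λ a → map (λ b → (a , b)) (upTo (R2 + 3))) (upTo (R2 + 3))

-- max over admissible pairs of min_i prodTerm s n_i (0 if no admissible pair)
bound : ℕ → ℕ → ℕ → ℕ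
bound s R2 R' =
  foldr _⊔_ 0
    (map (λ { (a , b) → prodTerm s a ⊓ prodTerm s b })
      (filter (λ { (a , b) → admissible? s R2 R' a b }) (candidatePairs R2)))

-- Let s = r + 2 and fix a colouring of K_{R(s,s)−1} with no monochromatic K_s; N_b denotes the
-- colour-b neighbourhood of vertex 0.  Doubling vertex 0, with the edge between the twins coloured b,
-- gives a colouring of K_{R(s,s)} whose monochromatic K_s are exactly the twins together with a
-- colour-b K_r inside N_b.  As N_b contains no colour-b K_{r+1}, Zykov's clique-counting form of
-- Turán's theorem bounds their number by T(∣N_b∣, r) = ∏_{j<r} ⌈(∣N_b∣ − j)/r⌉.  Moreover
-- ∣N_1∣ + ∣N_2∣ = R(s,s) − 2, and ∣N_b∣ < R(s−1,s) since a larger N_b would contain a colour-b K_{s−1},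
-- completed by vertex 0, or a K_s of the other colour.  So n_b = ∣N_b∣ + 2 is an admissible pair,
-- unless some T(∣N_b∣, r) vanishes and there is nothing to prove.

module Submission where

open import Defs hiding (sym)
open import Algebra.Properties.CommutativeSemigroup using (interchange; x∙yz≈y∙xz)
open import Data.Bool using (Bool; true; false; not; if_then_else_)
open import Data.Bool.Properties using (¬-not) renaming (_≟_ to _≟ᵇ_)
open import Data.Fin using (Fin; zero; suc)
open import Data.Fin.Properties using (any?) renaming (_≟_ to _≟ᶠ_; suc-injective to fsuc-injective)
open import Data.Fin.Subset using (Subset; _∈_; _∉_; _⊆_; ∣_∣; inside; outside; ⊥; ⁅_⁆; _∪_; _∩_; ∁; Empty)
open import Data.Fin.Subset.Properties
  using (_∈?_; _⊆?_; anySubset?; ∪-identityˡ; p⊆p∪q; q⊆p∪q; x∈p∪q⁻; x∈⁅x⁆; x∈⁅y⁆⇒x≡y;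
         x∈p∩q⁺; x∈p∩q⁻; x∉p⇒x∈∁p; ∣p∩q∣≤∣p∣; p⊆q⇒∣p∣≤∣q∣; Empty-unique; ∣p∣≤n; ∣⊥∣≡0; ∉⊥)
open import Data.List using (List; []; _∷_; map; length; filter; _++_; foldr; upTo; applyUpTo)
open import Data.List.Membership.Propositional using () renaming (_∈_ to _∈ₗ_)
open import Data.List.Membership.Propositional.Properties
  using (∈-map⁺; ∈-map⁻; ∈-filter⁺; ∈-concatMap⁺; ∈-applyUpTo⁺)
open import Data.List.Properties using (length-map; length-++; filter-++; length-applyUpTo; map-upTo)
open import Data.List.Relation.Unary.All.Properties using (applyUpTo⁺₁)
open import Data.List.Relation.Unary.Any as Any using (here; there)
open import Data.Nat
open import Data.Nat.DivMod
open import Data.Nat.Divisibility using (n∣m*n)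
open import Data.Nat.ListAction using (sum; product)
open import Data.Nat.ListAction.Properties using (product≢0)
open import Data.Nat.Properties
open import Data.Nat.Tactic.RingSolver using (solve-∀)
open import Data.Product as Product using (∃; _×_; _,_; proj₁; proj₂)
open import Data.Sum as Sum using (_⊎_; inj₁; inj₂)
open import Data.Vec using ([]; _∷_; here; there; tabulate)
open import Data.Vec.Properties using ([]=⇒lookup; lookup⇒[]=; lookup∘tabulate)
open import Function using (_∘_; id; case_of_)
open import Relation.Binary.Definitions using (tri<; tri≈; tri>)
open import Relation.Binary.PropositionalEquality
open import Relation.Nullary using (¬_; Dec; yes; no; does; contradiction)
open import Relation.Nullary.Decidable using (_×-dec_; _⊎-dec_; ¬?; dec-true; dec-false; decidable-stable)
open import Relation.Unary using (Decidable)

applyUpTo-cong : ∀ {A : Set} {f g : ℕ → A} k → (∀ {j} → j < k → f j ≡ g j) → applyUpTo f k ≡ applyUpTo g k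
applyUpTo-cong zero    f≡g = refl
applyUpTo-cong (suc k) f≡g = cong₂ _∷_ (f≡g z<s) (applyUpTo-cong k (f≡g ∘ s<s))

module _ {_∙_ : ℕ → ℕ → ℕ} {ε : ℕ} (∙-leftComm : ∀ x y z → x ∙ (y ∙ z) ≡ y ∙ (x ∙ z)) where

  foldr-applyUpTo-at : ∀ f {t k} → t < k → ∃ λ C →
    ∀ g → (∀ {j} → j < k → j ≢ t → g j ≡ f j) → foldr _∙_ ε (applyUpTo g k) ≡ g t ∙ C
  foldr-applyUpTo-at f {zero} {suc k} _ = foldr _∙_ ε (applyUpTo (f ∘ suc) k) , λ g g≡f →
    cong (g 0 ∙_) (cong (foldr _∙_ ε) (applyUpTo-cong k (λ j<k → g≡f (s<s j<k) λ ())))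
  foldr-applyUpTo-at f {suc t} {suc k} (s<s t<k) with foldr-applyUpTo-at (f ∘ suc) t<k
  ... | C , factor = f 0 ∙ C , λ g g≡f → begin
      g 0 ∙ foldr _∙_ ε (applyUpTo (g ∘ suc) k)
    ≡⟨ cong₂ _∙_ (g≡f z<s λ ()) (factor (g ∘ suc) λ j<k j≢t → g≡f (s<s j<k) (j≢t ∘ suc-injective)) ⟩
      f 0 ∙ (g (suc t) ∙ C)
    ≡⟨ ∙-leftComm (f 0) (g (suc t)) C ⟩
      g (suc t) ∙ (f 0 ∙ C)
    ∎
    where open ≡-Reasoning

sum-applyUpTo-at : ∀ f {t k} → t < k → ∃ λ C →
  ∀ g → (∀ {j} → j < k → j ≢ t → g j ≡ f j) → sum (applyUpTo g k) ≡ g t + C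
sum-applyUpTo-at = foldr-applyUpTo-at (x∙yz≈y∙xz +-commutativeSemigroup)

product-applyUpTo-at : ∀ f {t k} → t < k → ∃ λ C →
  ∀ g → (∀ {j} → j < k → j ≢ t → g j ≡ f j) → product (applyUpTo g k) ≡ g t * C
product-applyUpTo-at = foldr-applyUpTo-at (x∙yz≈y∙xz *-commutativeSemigroup)

sum<length⇒product≡0 : ∀ ns → sum ns < length ns → product ns ≡ 0
sum<length⇒product≡0 (zero  ∷ ns) _ = refl
sum<length⇒product≡0 (suc n ∷ ns) (s<s Σ<len) =
  trans (cong (suc n *_) (sum<length⇒product≡0 ns (≤-trans (s≤s (m≤n+m _ n)) Σ<len))) (*-zeroʳ (suc n))

sum≤length⇒product≤1 : ∀ ns → sum ns ≤ length ns → product ns ≤ 1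
sum≤length⇒product≤1 []                 _           = ≤-refl
sum≤length⇒product≤1 (zero        ∷ ns) _           = z≤n
sum≤length⇒product≤1 (suc zero    ∷ ns) (s≤s Σ≤len) =
  subst (_≤ 1) (sym (+-identityʳ _)) (sum≤length⇒product≤1 ns Σ≤len)
sum≤length⇒product≤1 (suc (suc n) ∷ ns) (s≤s Σ<len) =
  subst (_≤ 1) (sym (trans (cong (suc (suc n) *_) (sum<length⇒product≡0 ns (≤-trans (s≤s (m≤n+m _ n)) Σ<len)))
                           (*-zeroʳ (suc (suc n))))) z≤n

pigeonhole : ∀ q k (x : ℕ → ℕ) → q * k < sum (applyUpTo x k) → ∃ λ i → i < k × q < x i
pigeonhole q zero    x qk<Σ = contradiction (subst (_< 0) (*-zeroʳ q) qk<Σ) n≮0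
pigeonhole q (suc k) x qk<Σ with q <? x 0
... | yes q<x₀ = 0 , z<s , q<x₀
... | no  q≮x₀ with pigeonhole q k (x ∘ suc) (+-cancelˡ-< q _ _ (begin-strict
        q + q * k                          ≡⟨ *-suc q k ⟨
        q * suc k                          <⟨ qk<Σ ⟩
        x 0 + sum (applyUpTo (x ∘ suc) k)  ≤⟨ +-monoˡ-≤ _ (≮⇒≥ q≮x₀) ⟩
        q + sum (applyUpTo (x ∘ suc) k)    ∎))
  where open ≤-Reasoning
...   | i , i<k , q<xᵢ = suc i , s<s i<k , q<xᵢ

-- Balanced partitions

ceilDiv-* : ∀ p k → ceilDiv (p * suc k) (suc k) ≡ p
ceilDiv-* p k = begin
  (p * suc k + k) / suc k           ≡⟨ +-distrib-/-∣ˡ k (n∣m*n p) ⟩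
  p * suc k / suc k + k / suc k     ≡⟨ cong₂ _+_ (m*n/n≡m p (suc k)) (m<n⇒m/n≡0 (n<1+n k)) ⟩
  p + 0                             ≡⟨ +-identityʳ p ⟩
  p                                 ∎
  where open ≡-Reasoning

ceilDiv-*-+ : ∀ p {e k} → e ≤ k → ceilDiv (p * suc k + suc e) (suc k) ≡ suc p
ceilDiv-*-+ p {e} {k} e≤k = begin
  (p * suc k + suc e + k) / suc k       ≡⟨ cong (_/ suc k) (shift p e k) ⟩
  (suc p * suc k + e) / suc k           ≡⟨ +-distrib-/-∣ˡ e (n∣m*n (suc p)) ⟩
  suc p * suc k / suc k + e / suc k     ≡⟨ cong₂ _+_ (m*n/n≡m (suc p) (suc k)) (m<n⇒m/n≡0 (s≤s e≤k)) ⟩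
  suc p + 0                             ≡⟨ +-identityʳ (suc p) ⟩
  suc p                                 ∎
  where
  open ≡-Reasoning
  shift : ∀ p e k → p * suc k + suc e + k ≡ suc p * suc k + e
  shift = solve-∀

-- ⌈(m − j)/k⌉ for j < k are the part sizes of the balanced partition of m into k parts, so
-- balancedProduct m k, written T(m, k) below, counts the k-cliques of the Turán graph on m vertices.
balancedPart : ℕ → ℕ → ℕ → ℕ
balancedPart m k j = ceilDiv (m ∸ j) k

balancedProduct : ℕ → ℕ → ℕ
balancedProduct m k = product (applyUpTo (balancedPart m k) k)

private
  ∸-≡ : ∀ {m} j {a} → m ≡ j + a → m ∸ j ≡ a
  ∸-≡ j {a} refl = m+n∸m≡n j a

balancedPart-% : ∀ m k → balancedPart m (suc k) (m % suc k) ≡ m / suc k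
balancedPart-% m k =
  trans (cong (λ a → ceilDiv a (suc k)) (∸-≡ (m % suc k) (m≡m%n+[m/n]*n m (suc k)))) (ceilDiv-* (m / suc k) k)

balancedPart-suc-% : ∀ m k → balancedPart (suc m) (suc k) (m % suc k) ≡ suc (m / suc k)
balancedPart-suc-% m k =
  trans (cong (λ a → ceilDiv a (suc k)) (∸-≡ (m % suc k) (shift (m % suc k) (m / suc k * suc k) (m≡m%n+[m/n]*n m (suc k)))))
        (ceilDiv-*-+ (m / suc k) z≤n)
  where
  shift : ∀ {m} t a → m ≡ t + a → suc m ≡ t + (a + 1)
  shift t a refl = trans (sym (+-suc t a)) (cong (t +_) (+-comm 1 a))

private
  balancedPart-inexact : ∀ {m} j p {e k} → m ≡ j + (p * suc k + suc e) → e ≤ k → balancedPart m (suc k) j ≡ suc p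
  balancedPart-inexact j p {k = k} m≡ e≤k = trans (cong (λ a → ceilDiv a (suc k)) (∸-≡ j m≡)) (ceilDiv-*-+ p e≤k)

  -- With m = q k + t, both ⌈(m − j)/k⌉ and ⌈(m + 1 − j)/k⌉ are q + 1 for j < t and q for j > t.
  balancedPart-suc-≢-divMod : ∀ q t k {j} → t < suc k → j < suc k → j ≢ t →
    balancedPart (suc (q * suc k + t)) (suc k) j ≡ balancedPart (q * suc k + t) (suc k) j
  balancedPart-suc-≢-divMod q t k {j} t<K j<K j≢t with <-cmp j t
  ... | tri≈ _ j≡t _ = contradiction j≡t j≢t
  ... | tri< j<t _ _ with m≤n⇒∃[o]m+o≡n j<t
  ...   | e , refl = trans (balancedPart-inexact j q (shape₁ q j e k) (≤-trans (s≤s (m≤n+m e j)) (s≤s⁻¹ t<K)))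
                           (sym (balancedPart-inexact j q (shape₀ q j e k) (≤-trans (m≤n+m e (suc j)) (s≤s⁻¹ t<K))))
    where
    shape₀ : ∀ q j e k → q * suc k + (suc j + e) ≡ j + (q * suc k + suc e)
    shape₀ = solve-∀
    shape₁ : ∀ q j e k → suc (q * suc k + (suc j + e)) ≡ j + (q * suc k + suc (suc e))
    shape₁ = solve-∀
  balancedPart-suc-≢-divMod zero t k {j} t<K j<K j≢t | tri> _ _ t<j =
    cong (λ a → ceilDiv a (suc k)) (trans (m≤n⇒m∸n≡0 t<j) (sym (m≤n⇒m∸n≡0 (<⇒≤ t<j))))
  balancedPart-suc-≢-divMod (suc p) t k {j} t<K j<K j≢t | tri> _ _ t<j with m≤n⇒∃[o]m+o≡n t<j
  ...   | e , refl with m≤n⇒∃[o]m+o≡n j<K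
  ...     | f , refl = trans (balancedPart-inexact j p (shape₁ p t e f) (s≤s (+-monoˡ-≤ f (m≤m+n t e))))
                             (sym (balancedPart-inexact j p (shape₀ p t e f) (≤-trans (+-monoˡ-≤ f (m≤m+n t e)) (n≤1+n _))))
    where
    shape₀ : ∀ p t e f → suc p * suc (suc t + e + f) + t ≡ suc t + e + (p * suc (suc t + e + f) + suc (t + f))
    shape₀ = solve-∀
    shape₁ : ∀ p t e f → suc (suc p * suc (suc t + e + f) + t) ≡ suc t + e + (p * suc (suc t + e + f) + suc (suc (t + f)))
    shape₁ = solve-∀

balancedPart-suc-≢ : ∀ m k {j} → j < suc k → j ≢ m % suc k →
  balancedPart (suc m) (suc k) j ≡ balancedPart m (suc k) j
balancedPart-suc-≢ m k {j} j<K j≢t =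
  subst (λ n → balancedPart (suc n) (suc k) j ≡ balancedPart n (suc k) j) (sym m≡)
    (balancedPart-suc-≢-divMod (m / suc k) (m % suc k) k (m%n<n m (suc k)) j<K j≢t)
  where
  m≡ : m ≡ m / suc k * suc k + m % suc k
  m≡ = trans (m≡m%n+[m/n]*n m (suc k)) (+-comm (m % suc k) _)

balancedProduct-suc : ∀ m k → ∃ λ C →
  balancedProduct m (suc k) ≡ m / suc k * C × balancedProduct (suc m) (suc k) ≡ suc (m / suc k) * C
balancedProduct-suc m k with product-applyUpTo-at (balancedPart m (suc k)) (m%n<n m (suc k))
... | C , factor = C
  , trans (factor (balancedPart m (suc k)) (λ _ _ → refl)) (cong (_* C) (balancedPart-% m k))
  , trans (factor (balancedPart (suc m) (suc k)) (balancedPart-suc-≢ m k)) (cong (_* C) (balancedPart-suc-% m k))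

sum-balancedParts : ∀ m k → sum (applyUpTo (balancedPart m (suc k)) (suc k)) ≡ m
sum-balancedParts zero k =
  trans (cong sum (applyUpTo-cong (suc k) λ {j} _ → cong (λ a → ceilDiv a (suc k)) (0∸n≡0 j)))
        (sum-zero (suc k) (m<n⇒m/n≡0 (n<1+n k)))
  where
  sum-zero : ∀ {c} n → c ≡ 0 → sum (applyUpTo (λ _ → c) n) ≡ 0
  sum-zero zero    _   = refl
  sum-zero (suc n) refl = sum-zero n refl
sum-balancedParts (suc m) k with sum-applyUpTo-at (balancedPart m (suc k)) (m%n<n m (suc k))
... | D , split = begin
  sum (applyUpTo (balancedPart (suc m) (suc k)) (suc k))  ≡⟨ split _ (balancedPart-suc-≢ m k) ⟩
  balancedPart (suc m) (suc k) (m % suc k) + D            ≡⟨ cong (_+ D) (balancedPart-suc-% m k) ⟩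
  suc (m / suc k + D)                                     ≡⟨ cong (λ a → suc (a + D)) (balancedPart-% m k) ⟨
  suc (balancedPart m (suc k) (m % suc k) + D)            ≡⟨ cong suc (split _ λ _ _ → refl) ⟨
  suc (sum (applyUpTo (balancedPart m (suc k)) (suc k)))  ≡⟨ cong suc (sum-balancedParts m k) ⟩
  suc m                                                   ∎
  where open ≡-Reasoning

sum-balancedParts-≤ : ∀ m k → sum (applyUpTo (balancedPart m k) k) ≤ m
sum-balancedParts-≤ m zero    = z≤n
sum-balancedParts-≤ m (suc k) = ≤-reflexive (sum-balancedParts m k)

sum<-applyUpTo⇒product≡0 : ∀ k (x : ℕ → ℕ) → sum (applyUpTo x k) < k → product (applyUpTo x k) ≡ 0
sum<-applyUpTo⇒product≡0 k x Σ<k =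
  sum<length⇒product≡0 (applyUpTo x k) (subst (sum (applyUpTo x k) <_) (sym (length-applyUpTo x k)) Σ<k)

balancedProduct≡0 : ∀ {m k} → m < k → balancedProduct m k ≡ 0
balancedProduct≡0 {m} {k} m<k = sum<-applyUpTo⇒product≡0 k _ (≤-<-trans (sum-balancedParts-≤ m k) m<k)

balancedProduct-self>0 : ∀ k → balancedProduct k k > 0
balancedProduct-self>0 zero    = z<s
balancedProduct-self>0 (suc k) = >-nonZero⁻¹ _ {{product≢0 (applyUpTo⁺₁ _ (suc k) part>0)}}
  where
  part>0 : ∀ {j} → j < suc k → NonZero (balancedPart (suc k) (suc k) j)
  part>0 {j} j<K = >-nonZero (m≥n⇒m/n>0 (+-monoˡ-≤ k (m<n⇒0<n∸m j<K)))

balancedProduct-≤-suc : ∀ m k → balancedProduct m k ≤ balancedProduct (suc m) k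
balancedProduct-≤-suc m zero    = ≤-refl
balancedProduct-≤-suc m (suc k) with balancedProduct-suc m k
... | C , Bm≡ , Bsm≡ = subst₂ _≤_ (sym Bm≡) (sym Bsm≡) (*-monoˡ-≤ C (n≤1+n (m / suc k)))

-- Some xᵢ exceeds q = m / k; moving one unit out of it gives a vector of sum m, bounded by
-- induction, and xᵢ − 1 ≥ q transfers that bound to the remaining factors.
private
  product-≤-balancedProduct-step : ∀ m k q (x : ℕ → ℕ) → m / suc k ≡ suc q → sum (applyUpTo x (suc k)) ≡ suc m →
    (∀ y → sum (applyUpTo y (suc k)) ≤ m → product (applyUpTo y (suc k)) ≤ balancedProduct m (suc k)) →
    product (applyUpTo x (suc k)) ≤ balancedProduct (suc m) (suc k)
  product-≤-balancedProduct-step m k q x m/K≡ Σx≡ induction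
    with pigeonhole (suc q) (suc k) x (let open ≤-Reasoning in begin-strict
           suc q * suc k                ≡⟨ cong (_* suc k) m/K≡ ⟨
           m / suc k * suc k            ≤⟨ m/n*n≤m m (suc k) ⟩
           m                            <⟨ n<1+n m ⟩
           suc m                        ≡⟨ Σx≡ ⟨
           sum (applyUpTo x (suc k))    ∎)
  ... | i , i<K , q<xᵢ
    with product-applyUpTo-at x i<K | sum-applyUpTo-at x i<K | balancedProduct-suc m k
  ... | R , factor | D , split | C , Bm≡ , Bsm≡ = begin
      product (applyUpTo x (suc k))      ≡⟨ factor x (λ _ _ → refl) ⟩
      x i * R                            ≡⟨ cong (_* R) (suc-pred (x i)) ⟨
      R + pred (x i) * R                 ≤⟨ +-mono-≤ R≤C yᵢR≤ ⟩
      C + suc q * C                      ≡⟨ cong (λ a → suc a * C) m/K≡ ⟨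
      suc (m / suc k) * C                ≡⟨ Bsm≡ ⟨
      balancedProduct (suc m) (suc k)    ∎
    where
    open ≤-Reasoning
    instance
      xᵢ≢0 : NonZero (x i)
      xᵢ≢0 = >-nonZero (<-trans z<s q<xᵢ)
    y : ℕ → ℕ
    y j = if does (j ≟ i) then pred (x i) else x j
    y≡x : ∀ {j} → j < suc k → j ≢ i → y j ≡ x j
    y≡x {j} _ j≢i = cong (if_then pred (x i) else x j) (dec-false (j ≟ i) j≢i)
    yᵢ≡ : y i ≡ pred (x i)
    yᵢ≡ = cong (if_then pred (x i) else x i) (dec-true (i ≟ i) refl)
    Σy≡m : sum (applyUpTo y (suc k)) ≡ m
    Σy≡m = suc-injective (begin-equality
      suc (sum (applyUpTo y (suc k)))   ≡⟨ cong suc (split y y≡x) ⟩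
      suc (y i + D)                     ≡⟨ cong (λ a → suc a + D) yᵢ≡ ⟩
      suc (pred (x i)) + D              ≡⟨ cong (_+ D) (suc-pred (x i)) ⟩
      x i + D                           ≡⟨ split x (λ _ _ → refl) ⟨
      sum (applyUpTo x (suc k))         ≡⟨ Σx≡ ⟩
      suc m                             ∎)
    yᵢR≤ : pred (x i) * R ≤ suc q * C
    yᵢR≤ = begin
      pred (x i) * R                    ≡⟨ cong (_* R) yᵢ≡ ⟨
      y i * R                           ≡⟨ factor y y≡x ⟨
      product (applyUpTo y (suc k))     ≤⟨ induction y (≤-reflexive Σy≡m) ⟩
      balancedProduct m (suc k)         ≡⟨ Bm≡ ⟩
      m / suc k * C                     ≡⟨ cong (_* C) m/K≡ ⟩
      suc q * C                         ∎
    R≤C : R ≤ C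
    R≤C = *-cancelˡ-≤ (suc q) (≤-trans (*-monoˡ-≤ R (pred-mono-≤ q<xᵢ)) yᵢR≤)

product-≤-balancedProduct : ∀ m k (x : ℕ → ℕ) → sum (applyUpTo x k) ≤ m →
  product (applyUpTo x k) ≤ balancedProduct m k
product-≤-balancedProduct m       zero    x _     = ≤-refl
product-≤-balancedProduct zero    (suc k) x Σx≤0  =
  ≤-trans (≤-reflexive (sum<-applyUpTo⇒product≡0 (suc k) x (≤-<-trans Σx≤0 z<s))) z≤n
product-≤-balancedProduct (suc m) (suc k) x Σx≤ with sum (applyUpTo x (suc k)) ≤? m
... | yes Σx≤m = ≤-trans (product-≤-balancedProduct m (suc k) x Σx≤m) (balancedProduct-≤-suc m (suc k))
... | no  Σx≰m with m / suc k in m/K≡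
...   | suc q = product-≤-balancedProduct-step m k q x m/K≡ Σx≡ (product-≤-balancedProduct m (suc k))
  where
  Σx≡ : sum (applyUpTo x (suc k)) ≡ suc m
  Σx≡ = ≤-antisym Σx≤ (≰⇒> Σx≰m)
...   | zero with suc m <? suc k
...     | yes m<k = ≤-trans (≤-reflexive (sum<-applyUpTo⇒product≡0 (suc k) x (≤-<-trans Σx≤ m<k))) z≤n
...     | no  m≮k = begin
  product (applyUpTo x (suc k))           ≤⟨ sum≤length⇒product≤1 (applyUpTo x (suc k)) Σx≤len ⟩
  1                                       ≤⟨ balancedProduct-self>0 (suc m) ⟩
  balancedProduct (suc m) (suc m)         ≡⟨ cong (balancedProduct (suc m)) m≡k ⟩
  balancedProduct (suc m) (suc k)         ∎
  where
  open ≤-Reasoning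
  m≡k : suc m ≡ suc k
  m≡k = ≤-antisym (m/n≡0⇒m<n m/K≡) (≮⇒≥ m≮k)
  Σx≤len : sum (applyUpTo x (suc k)) ≤ length (applyUpTo x (suc k))
  Σx≤len = subst (sum (applyUpTo x (suc k)) ≤_) (trans m≡k (sym (length-applyUpTo x (suc k)))) Σx≤

balancedProduct-mono : ∀ {m m′} k → m ≤ m′ → balancedProduct m k ≤ balancedProduct m′ k
balancedProduct-mono {m} {m′} k m≤m′ =
  product-≤-balancedProduct m′ k (balancedPart m k) (≤-trans (sum-balancedParts-≤ m k) m≤m′)

-- The left side is the product of the partition of n into n − d and the balanced r-partition of d.
balancedProduct-split : ∀ {n d} r → d ≤ n → (n ∸ d) * balancedProduct d r ≤ balancedProduct n (suc r)
balancedProduct-split {n} {d} r d≤n = product-≤-balancedProduct n (suc r) x (begin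
  n ∸ d + sum (applyUpTo (balancedPart d r) r)  ≤⟨ +-monoʳ-≤ (n ∸ d) (sum-balancedParts-≤ d r) ⟩
  n ∸ d + d                                     ≡⟨ m∸n+n≡m d≤n ⟩
  n                                             ∎)
  where
  open ≤-Reasoning
  x : ℕ → ℕ
  x zero    = n ∸ d
  x (suc j) = balancedPart d r j

prodTerm≡balancedProduct : ∀ s n → prodTerm s n ≡ balancedProduct (n ∸ 2) (s ∸ 2)
prodTerm≡balancedProduct s n = cong product (map-upTo _ (s ∸ 2))

select : ∀ {n} {P : Fin n → Set} → Decidable P → Subset n
select P? = tabulate (does ∘ P?)

module _ {n} {P : Fin n → Set} (P? : Decidable P) where

  ∈-select⁺ : ∀ {y} → P y → y ∈ select P?
  ∈-select⁺ {y} Py = lookup⇒[]= y _ (trans (lookup∘tabulate (does ∘ P?) y) (dec-true (P? y) Py))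

  ∈-select⁻ : ∀ {y} → y ∈ select P? → P y
  ∈-select⁻ {y} y∈ with P? y | trans (sym (lookup∘tabulate (does ∘ P?) y)) ([]=⇒lookup y∈)
  ... | yes Py | _ = Py

maximiser : ∀ {n} (f : Fin n → ℕ) (V : Subset n) → Empty V ⊎ ∃ λ x → x ∈ V × (∀ {y} → y ∈ V → f y ≤ f x)
maximiser f [] = inj₁ λ ()
maximiser f (a ∷ V) with maximiser (f ∘ suc) V
maximiser f (outside ∷ V) | inj₁ empty = inj₁ λ { (suc y , there y∈V) → empty (y , y∈V) }
maximiser f (inside  ∷ V) | inj₁ empty =
  inj₂ (zero , here , λ { here → ≤-refl ; (there y∈V) → contradiction (_ , y∈V) empty })
maximiser f (outside ∷ V) | inj₂ (x , x∈V , max) = inj₂ (suc x , there x∈V , λ { (there y∈V) → max y∈V })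
maximiser f (inside  ∷ V) | inj₂ (x , x∈V , max) with f zero ≤? f (suc x)
... | yes f₀≤ = inj₂ (suc x , there x∈V , λ { here → f₀≤ ; (there y∈V) → max y∈V })
... | no  f₀≰ = inj₂ (zero , here , λ { here → ≤-refl ; (there y∈V) → ≤-trans (max y∈V) (<⇒≤ (≰⇒> f₀≰)) })

∣p∩q∣+∣p∩∁q∣≡∣p∣ : ∀ {n} (p q : Subset n) → ∣ p ∩ q ∣ + ∣ p ∩ ∁ q ∣ ≡ ∣ p ∣
∣p∩q∣+∣p∩∁q∣≡∣p∣ []            []            = refl
∣p∩q∣+∣p∩∁q∣≡∣p∣ (inside  ∷ p) (inside  ∷ q) = cong suc (∣p∩q∣+∣p∩∁q∣≡∣p∣ p q)
∣p∩q∣+∣p∩∁q∣≡∣p∣ (inside  ∷ p) (outside ∷ q) =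
  trans (+-suc _ _) (cong suc (∣p∩q∣+∣p∩∁q∣≡∣p∣ p q))
∣p∩q∣+∣p∩∁q∣≡∣p∣ (outside ∷ p) (_       ∷ q) = ∣p∩q∣+∣p∩∁q∣≡∣p∣ p q

∣⁅y⁆∪p∣≡1+∣p∣ : ∀ {n} (y : Fin n) p → y ∉ p → ∣ ⁅ y ⁆ ∪ p ∣ ≡ suc ∣ p ∣
∣⁅y⁆∪p∣≡1+∣p∣ zero    (inside  ∷ p) y∉p = contradiction here y∉p
∣⁅y⁆∪p∣≡1+∣p∣ zero    (outside ∷ p) _   = cong (suc ∘ ∣_∣) (∪-identityˡ p)
∣⁅y⁆∪p∣≡1+∣p∣ (suc y) (inside  ∷ p) y∉p = cong suc (∣⁅y⁆∪p∣≡1+∣p∣ y p (y∉p ∘ there))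
∣⁅y⁆∪p∣≡1+∣p∣ (suc y) (outside ∷ p) y∉p = ∣⁅y⁆∪p∣≡1+∣p∣ y p (y∉p ∘ there)

count : ∀ {n} {P : Subset n → Set} → Decidable P → ℕ
count {zero}  P? = if does (P? []) then 1 else 0
count {suc n} P? = count (P? ∘ (inside ∷_)) + count (P? ∘ (outside ∷_))

count-mono : ∀ {n} {P Q : Subset n → Set} (P? : Decidable P) (Q? : Decidable Q) →
  (∀ p → P p → Q p) → count P? ≤ count Q?
count-mono {zero} P? Q? P⇒Q with P? [] | Q? []
... | yes p | yes _ = ≤-refl
... | yes p | no ¬q = contradiction (P⇒Q [] p) ¬q
... | no _  | _     = z≤n
count-mono {suc n} P? Q? P⇒Q =
  +-mono-≤ (count-mono (P? ∘ (inside ∷_)) (Q? ∘ (inside ∷_)) (P⇒Q ∘ (inside ∷_)))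
           (count-mono (P? ∘ (outside ∷_)) (Q? ∘ (outside ∷_)) (P⇒Q ∘ (outside ∷_)))

count≡0 : ∀ {n} {P : Subset n → Set} (P? : Decidable P) → (∀ p → ¬ P p) → count P? ≡ 0
count≡0 {zero} P? ¬P with P? []
... | yes p = contradiction p (¬P [])
... | no _  = refl
count≡0 {suc n} P? ¬P =
  cong₂ _+_ (count≡0 (P? ∘ (inside ∷_)) (¬P ∘ (inside ∷_))) (count≡0 (P? ∘ (outside ∷_)) (¬P ∘ (outside ∷_)))

count-⊎ : ∀ {n} {P Q R : Subset n → Set} (P? : Decidable P) (Q? : Decidable Q) (R? : Decidable R) →
  (∀ p → P p → Q p ⊎ R p) → count P? ≤ count Q? + count R?
count-⊎ {zero} P? Q? R? P⇒Q⊎R with P? [] | Q? [] | R? []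
... | no _  | _     | _     = z≤n
... | yes _ | yes _ | _     = s≤s z≤n
... | yes _ | no _  | yes _ = s≤s z≤n
... | yes p | no ¬q | no ¬r with P⇒Q⊎R [] p
...   | inj₁ q = contradiction q ¬q
...   | inj₂ r = contradiction r ¬r
count-⊎ {suc n} P? Q? R? P⇒Q⊎R =
  ≤-trans (+-mono-≤ (count-⊎ (P? ∘ (inside ∷_)) (Q? ∘ (inside ∷_)) (R? ∘ (inside ∷_)) (P⇒Q⊎R ∘ (inside ∷_)))
                    (count-⊎ (P? ∘ (outside ∷_)) (Q? ∘ (outside ∷_)) (R? ∘ (outside ∷_)) (P⇒Q⊎R ∘ (outside ∷_))))
          (≤-reflexive (interchange +-commutativeSemigroup (count (Q? ∘ (inside ∷_))) (count (R? ∘ (inside ∷_)))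
                                                            (count (Q? ∘ (outside ∷_))) (count (R? ∘ (outside ∷_)))))

count-∣∣≡0 : ∀ {n} → count {n} (λ q → ∣ q ∣ ≟ 0) ≡ 1
count-∣∣≡0 {zero}  = refl
count-∣∣≡0 {suc n} = cong₂ _+_ (count≡0 (λ (q : Subset n) → ∣ inside ∷ q ∣ ≟ 0) (λ _ ())) (count-∣∣≡0 {n})

count-∈-≤ : ∀ {n} (y : Fin n) {P Q : Subset n → Set} (P? : Decidable P) (Q? : Decidable Q) →
  (∀ q → y ∉ q → P (⁅ y ⁆ ∪ q) → Q q) → count (λ q → (y ∈? q) ×-dec P? q) ≤ count Q?
count-∈-≤ {suc n} zero {P} {Q} P? Q? h = begin
  count through₀ + count avoiding₀    ≡⟨ cong (count through₀ +_) (count≡0 avoiding₀ λ _ → λ ()) ⟩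
  count through₀ + 0                  ≡⟨ +-identityʳ _ ⟩
  count through₀                      ≤⟨ count-mono through₀ (Q? ∘ (outside ∷_)) moved ⟩
  count (Q? ∘ (outside ∷_))           ≤⟨ m≤n+m _ (count (Q? ∘ (inside ∷_))) ⟩
  count Q?                            ∎
  where
  open ≤-Reasoning
  through₀ : Decidable (λ q → zero ∈ inside ∷ q × P (inside ∷ q))
  through₀ q = (zero ∈? (inside ∷ q)) ×-dec P? (inside ∷ q)
  avoiding₀ : Decidable (λ q → zero ∈ outside ∷ q × P (outside ∷ q))
  avoiding₀ q = (zero ∈? (outside ∷ q)) ×-dec P? (outside ∷ q)
  moved : ∀ q → zero ∈ inside ∷ q × P (inside ∷ q) → Q (outside ∷ q)
  moved q (_ , Pq) = h (outside ∷ q) (λ ()) (subst P (cong (inside ∷_) (sym (∪-identityˡ q))) Pq)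
count-∈-≤ {suc n} (suc y) P? Q? h = +-mono-≤ (half inside) (half outside)
  where
  half : ∀ a → count (λ q → (suc y ∈? (a ∷ q)) ×-dec P? (a ∷ q)) ≤ count (Q? ∘ (a ∷_))
  half a = ≤-trans (count-mono (λ q → (suc y ∈? (a ∷ q)) ×-dec P? (a ∷ q)) (λ q → (y ∈? q) ×-dec P? (a ∷ q))
                               λ { q (there y∈q , Pq) → y∈q , Pq })
                   (count-∈-≤ y (P? ∘ (a ∷_)) (Q? ∘ (a ∷_)) λ q y∉q → h (a ∷ q) λ { (there y∈q) → y∉q y∈q })

elements : ∀ {n} → Subset n → List (Fin n)
elements []            = []
elements (inside  ∷ p) = zero ∷ map suc (elements p)
elements (outside ∷ p) = map suc (elements p)

length-elements : ∀ {n} (p : Subset n) → length (elements p) ≡ ∣ p ∣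
length-elements []            = refl
length-elements (inside  ∷ p) = cong suc (trans (length-map suc (elements p)) (length-elements p))
length-elements (outside ∷ p) = trans (length-map suc (elements p)) (length-elements p)

∈-elements⁻ : ∀ {n} (p : Subset n) {y} → y ∈ₗ elements p → y ∈ p
∈-elements⁻ (inside ∷ p) (here refl) = here
∈-elements⁻ (inside ∷ p) (there y∈) with ∈-map⁻ suc y∈
... | _ , y∈p , refl = there (∈-elements⁻ p y∈p)
∈-elements⁻ (outside ∷ p) y∈ with ∈-map⁻ suc y∈
... | _ , y∈p , refl = there (∈-elements⁻ p y∈p)

∈-elements⁺ : ∀ {n} (p : Subset n) {y} → y ∈ p → y ∈ₗ elements p
∈-elements⁺ (inside  ∷ p) here        = here refl
∈-elements⁺ (inside  ∷ p) (there y∈p) = there (∈-map⁺ suc (∈-elements⁺ p y∈p))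
∈-elements⁺ (outside ∷ p) (there y∈p) = ∈-map⁺ suc (∈-elements⁺ p y∈p)

private
  count-cover-list : ∀ {n} {P : Subset n → Set} (P? : Decidable P) (ys : List (Fin n)) b →
    (∀ q → P q → ∃ λ y → y ∈ₗ ys × y ∈ q) →
    (∀ {y} → y ∈ₗ ys → count (λ q → (y ∈? q) ×-dec P? q) ≤ b) →
    count P? ≤ length ys * b
  count-cover-list P? [] b cover _ = ≤-reflexive (count≡0 P? λ q Pq → case cover q Pq of λ ())
  count-cover-list {P = P} P? (y ∷ ys) b cover bound =
    ≤-trans (count-⊎ P? (λ q → (y ∈? q) ×-dec P? q) P∖y? split)
            (+-mono-≤ (bound (here refl)) (count-cover-list P∖y? ys b cover′ bound′))
    where
    P∖y? : Decidable (λ q → P q × y ∉ q)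
    P∖y? q = P? q ×-dec ¬? (y ∈? q)
    split : ∀ q → P q → (y ∈ q × P q) ⊎ (P q × y ∉ q)
    split q Pq with y ∈? q
    ... | yes y∈q = inj₁ (y∈q , Pq)
    ... | no  y∉q = inj₂ (Pq , y∉q)
    cover′ : ∀ q → P q × y ∉ q → ∃ λ y′ → y′ ∈ₗ ys × y′ ∈ q
    cover′ q (Pq , y∉q) with cover q Pq
    ... | _  , here refl , y∈q  = contradiction y∈q y∉q
    ... | y′ , there y′∈ , y′∈q = y′ , y′∈ , y′∈q
    bound′ : ∀ {y′} → y′ ∈ₗ ys → count (λ q → (y′ ∈? q) ×-dec P∖y? q) ≤ b
    bound′ {y′} y′∈ = ≤-trans (count-mono (λ q → (y′ ∈? q) ×-dec P∖y? q) (λ q → (y′ ∈? q) ×-dec P? q)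
                                          λ { q (y′∈q , Pq , _) → y′∈q , Pq })
                              (bound (there y′∈))

count-cover : ∀ {n} {P : Subset n → Set} (P? : Decidable P) (W : Subset n) b →
  (∀ q → P q → ∃ λ y → y ∈ W × y ∈ q) →
  (∀ {y} → y ∈ W → count (λ q → (y ∈? q) ×-dec P? q) ≤ b) →
  count P? ≤ ∣ W ∣ * b
count-cover P? W b cover bound = subst (λ l → count P? ≤ l * b) (length-elements W)
  (count-cover-list P? (elements W) b
    (λ q Pq → let y , y∈W , y∈q = cover q Pq in y , ∈-elements⁺ W y∈W , y∈q)
    (bound ∘ ∈-elements⁻ W))

private
  length-filter-map : ∀ {A B : Set} {P : B → Set} (P? : Decidable P) (f : A → B) xs →
    length (filter P? (map f xs)) ≡ length (filter (P? ∘ f) xs)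
  length-filter-map P? f []       = refl
  length-filter-map P? f (x ∷ xs) with does (P? (f x))
  ... | true  = cong suc (length-filter-map P? f xs)
  ... | false = length-filter-map P? f xs

length-filter-allSubsets : ∀ {n} {P : Subset n → Set} (P? : Decidable P) →
  length (filter P? (allSubsets n)) ≡ count P?
length-filter-allSubsets {zero} P? with does (P? [])
... | true  = refl
... | false = refl
length-filter-allSubsets {suc n} P? = begin
  length (filter P? (map (inside ∷_) (allSubsets n) ++ map (outside ∷_) (allSubsets n)))
    ≡⟨ cong length (filter-++ P? (map (inside ∷_) (allSubsets n)) (map (outside ∷_) (allSubsets n))) ⟩
  length (filter P? (map (inside ∷_) (allSubsets n)) ++ filter P? (map (outside ∷_) (allSubsets n)))
    ≡⟨ length-++ (filter P? (map (inside ∷_) (allSubsets n))) ⟩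
  length (filter P? (map (inside ∷_) (allSubsets n))) + length (filter P? (map (outside ∷_) (allSubsets n)))
    ≡⟨ cong₂ _+_ (half inside) (half outside) ⟩
  count P? ∎
  where
  open ≡-Reasoning
  half : ∀ a → length (filter P? (map (a ∷_) (allSubsets n))) ≡ count (P? ∘ (a ∷_))
  half a = trans (length-filter-map P? (a ∷_) (allSubsets n)) (length-filter-allSubsets (P? ∘ (a ∷_)))

-- Monochromatic cliques and Zykov's bound

module _ {n} (c : Coloring n) (b : Bool) (x : Fin n) where

  nbhd : Subset n
  nbhd = select (λ y → ¬? (y ≟ᶠ x) ×-dec (col c x y ≟ᵇ b))

  ∈-nbhd⁺ : ∀ {y} → y ≢ x → col c x y ≡ b → y ∈ nbhd
  ∈-nbhd⁺ y≢x xy≡b = ∈-select⁺ (λ y → ¬? (y ≟ᶠ x) ×-dec (col c x y ≟ᵇ b)) (y≢x , xy≡b)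

  ∈-nbhd⁻ : ∀ {y} → y ∈ nbhd → y ≢ x × col c x y ≡ b
  ∈-nbhd⁻ = ∈-select⁻ (λ y → ¬? (y ≟ᶠ x) ×-dec (col c x y ≟ᵇ b))

  ∉-nbhd : x ∉ nbhd
  ∉-nbhd x∈ = proj₁ (∈-nbhd⁻ x∈) refl

MonoCliqueIn : ∀ {n} → Coloring n → Bool → Subset n → ℕ → Subset n → Set
MonoCliqueIn c b V r q = q ⊆ V × ∣ q ∣ ≡ r × Mono c b q

monoCliqueIn? : ∀ {n} (c : Coloring n) b V r → Decidable (MonoCliqueIn c b V r)
monoCliqueIn? c b V r q = (q ⊆? V) ×-dec (∣ q ∣ ≟ r) ×-dec mono? c b q

cliqueCount : ∀ {n} → Coloring n → Bool → Subset n → ℕ → ℕ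
cliqueCount c b V r = count (monoCliqueIn? c b V r)

module _ {n} (c : Coloring n) (b : Bool) {V : Subset n} {r : ℕ} {y : Fin n} where

  MonoCliqueIn-extend : ∀ {q} → y ∈ V → MonoCliqueIn c b (V ∩ nbhd c b y) r q → MonoCliqueIn c b V (suc r) (⁅ y ⁆ ∪ q)
  MonoCliqueIn-extend {q} y∈V (q⊆ , ∣q∣≡r , mono) = ⁅y⁆∪q⊆V , ∣⁅y⁆∪q∣ , mono′
    where
    q⊆N : q ⊆ nbhd c b y
    q⊆N = proj₂ ∘ x∈p∩q⁻ V _ ∘ q⊆
    ⁅y⁆∪q⊆V : ⁅ y ⁆ ∪ q ⊆ V
    ⁅y⁆∪q⊆V z∈ with x∈p∪q⁻ ⁅ y ⁆ q z∈
    ... | inj₁ z∈⁅y⁆ rewrite x∈⁅y⁆⇒x≡y y z∈⁅y⁆ = y∈V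
    ... | inj₂ z∈q = proj₁ (x∈p∩q⁻ V _ (q⊆ z∈q))
    ∣⁅y⁆∪q∣ : ∣ ⁅ y ⁆ ∪ q ∣ ≡ suc r
    ∣⁅y⁆∪q∣ = trans (∣⁅y⁆∪p∣≡1+∣p∣ y q (∉-nbhd c b y ∘ q⊆N)) (cong suc ∣q∣≡r)
    edge : ∀ {z} → z ∈ q → col c y z ≡ b
    edge = proj₂ ∘ ∈-nbhd⁻ c b y ∘ q⊆N
    mono′ : Mono c b (⁅ y ⁆ ∪ q)
    mono′ i j i∈ j∈ i≢j with x∈p∪q⁻ ⁅ y ⁆ q i∈ | x∈p∪q⁻ ⁅ y ⁆ q j∈
    ... | inj₁ i∈⁅y⁆ | inj₁ j∈⁅y⁆ =
      contradiction (trans (x∈⁅y⁆⇒x≡y y i∈⁅y⁆) (sym (x∈⁅y⁆⇒x≡y y j∈⁅y⁆))) i≢j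
    ... | inj₁ i∈⁅y⁆ | inj₂ j∈q rewrite x∈⁅y⁆⇒x≡y y i∈⁅y⁆ = edge j∈q
    ... | inj₂ i∈q | inj₁ j∈⁅y⁆ rewrite x∈⁅y⁆⇒x≡y y j∈⁅y⁆ = trans (Coloring.sym c i y) (edge i∈q)
    ... | inj₂ i∈q | inj₂ j∈q = mono i j i∈q j∈q i≢j

  MonoCliqueIn-restrict : ∀ {q} → y ∉ q → MonoCliqueIn c b V (suc r) (⁅ y ⁆ ∪ q) → MonoCliqueIn c b (V ∩ nbhd c b y) r q
  MonoCliqueIn-restrict {q} y∉q (⊆V , ∣∣≡ , mono) =
      q⊆ , suc-injective (trans (sym (∣⁅y⁆∪p∣≡1+∣p∣ y q y∉q)) ∣∣≡)
    , λ i j i∈ j∈ → mono i j (q⊆⁅y⁆∪q i∈) (q⊆⁅y⁆∪q j∈)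
    where
    q⊆⁅y⁆∪q : q ⊆ ⁅ y ⁆ ∪ q
    q⊆⁅y⁆∪q = q⊆p∪q ⁅ y ⁆ q
    q⊆ : q ⊆ V ∩ nbhd c b y
    q⊆ {z} z∈q =
      x∈p∩q⁺ (⊆V (q⊆⁅y⁆∪q z∈q) , ∈-nbhd⁺ c b y z≢y (mono y z (p⊆p∪q q (x∈⁅x⁆ y)) (q⊆⁅y⁆∪q z∈q) (z≢y ∘ sym)))
      where
      z≢y : z ≢ y
      z≢y refl = y∉q z∈q

MonoCliqueIn-meets-∁nbhd : ∀ {n} (c : Coloring n) b {V : Subset n} {r x} → x ∈ V →
  (∀ q → ¬ MonoCliqueIn c b V (suc (suc r)) q) →
  ∀ q → MonoCliqueIn c b V (suc r) q → ∃ λ y → y ∈ V ∩ ∁ (nbhd c b x) × y ∈ q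
MonoCliqueIn-meets-∁nbhd c b {V} {x = x} x∈V free q (q⊆V , ∣q∣≡ , mono)
  with any? (λ y → (y ∈? V ∩ ∁ (nbhd c b x)) ×-dec (y ∈? q))
... | yes (y , y∈W , y∈q) = y , y∈W , y∈q
... | no  ∄y = contradiction (MonoCliqueIn-extend c b x∈V (q⊆ , ∣q∣≡ , mono)) (free (⁅ x ⁆ ∪ q))
  where
  q⊆ : q ⊆ V ∩ nbhd c b x
  q⊆ {z} z∈q with z ∈? nbhd c b x
  ... | yes z∈N = x∈p∩q⁺ (q⊆V z∈q , z∈N)
  ... | no  z∉N = contradiction (z , x∈p∩q⁺ (q⊆V z∈q , x∉p⇒x∈∁p z∉N) , z∈q) ∄y

-- Take x of maximum degree Δ in V.  Every clique of size r + 1 meets the non-neighbourhood of x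
-- (else adding x gives one of size r + 2), and those through y lie in the neighbourhood of y,
-- which has degree at most Δ; so the count is at most (∣V∣ − Δ) · T(Δ, r) ≤ T(∣V∣, r + 1).
cliqueCount≤balancedProduct : ∀ r {n} (c : Coloring n) b (V : Subset n) →
  (∀ q → ¬ MonoCliqueIn c b V (suc r) q) → cliqueCount c b V r ≤ balancedProduct ∣ V ∣ r
cliqueCount≤balancedProduct zero {n} c b V _ =
  ≤-trans (count-mono (monoCliqueIn? c b V 0) (λ q → ∣ q ∣ ≟ 0) (λ _ → proj₁ ∘ proj₂))
          (≤-reflexive (count-∣∣≡0 {n}))
cliqueCount≤balancedProduct (suc r) {n} c b V free with maximiser (λ y → ∣ V ∩ nbhd c b y ∣) V
... | inj₁ V-empty = ≤-trans (≤-reflexive (count≡0 (monoCliqueIn? c b V (suc r)) noClique)) z≤n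
  where
  ∣V∣≡0 : ∣ V ∣ ≡ 0
  ∣V∣≡0 = trans (cong ∣_∣ (Empty-unique V-empty)) (∣⊥∣≡0 n)
  noClique : ∀ q → ¬ MonoCliqueIn c b V (suc r) q
  noClique q (q⊆V , ∣q∣≡ , _) with subst₂ _≤_ ∣q∣≡ ∣V∣≡0 (p⊆q⇒∣p∣≤∣q∣ q⊆V)
  ... | ()
... | inj₂ (x , x∈V , max) = begin
  cliqueCount c b V (suc r)
    ≤⟨ count-cover (monoCliqueIn? c b V (suc r)) W _ (MonoCliqueIn-meets-∁nbhd c b x∈V free) perVertex ⟩
  ∣ W ∣ * balancedProduct Δ r           ≡⟨ cong (_* balancedProduct Δ r) ∣W∣≡ ⟩
  (∣ V ∣ ∸ Δ) * balancedProduct Δ r     ≤⟨ balancedProduct-split r (∣p∩q∣≤∣p∣ V (nbhd c b x)) ⟩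
  balancedProduct ∣ V ∣ (suc r)         ∎
  where
  open ≤-Reasoning
  Δ = ∣ V ∩ nbhd c b x ∣
  W = V ∩ ∁ (nbhd c b x)
  ∣W∣≡ : ∣ W ∣ ≡ ∣ V ∣ ∸ Δ
  ∣W∣≡ = trans (sym (m+n∸m≡n Δ ∣ W ∣)) (cong (_∸ Δ) (∣p∩q∣+∣p∩∁q∣≡∣p∣ V (nbhd c b x)))
  perVertex : ∀ {y} → y ∈ W → count (λ q → (y ∈? q) ×-dec monoCliqueIn? c b V (suc r) q) ≤ balancedProduct Δ r
  perVertex {y} y∈W = begin
    count (λ q → (y ∈? q) ×-dec monoCliqueIn? c b V (suc r) q)
      ≤⟨ count-∈-≤ y (monoCliqueIn? c b V (suc r)) (monoCliqueIn? c b (V ∩ nbhd c b y) r)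
                    (λ _ y∉q → MonoCliqueIn-restrict c b y∉q) ⟩
    cliqueCount c b (V ∩ nbhd c b y) r
      ≤⟨ cliqueCount≤balancedProduct r c b (V ∩ nbhd c b y)
           (λ q clique → free (⁅ y ⁆ ∪ q) (MonoCliqueIn-extend c b y∈V clique)) ⟩
    balancedProduct ∣ V ∩ nbhd c b y ∣ r
      ≤⟨ balancedProduct-mono r (max y∈V) ⟩
    balancedProduct Δ r ∎
    where
    y∈V : y ∈ V
    y∈V = proj₁ (x∈p∩q⁻ V _ y∈W)

pullback : ∀ {m n} → (Fin m → Fin n) → Coloring n → Coloring m
pullback e c = record { col = λ i j → col c (e i) (e j) ; sym = λ i j → Coloring.sym c (e i) (e j) }

record Embedding (m : ℕ) {n} (V : Subset n) : Set where
  field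
    embed   : Fin m → Fin n
    image   : Subset m → Subset n
    ∣image∣ : ∀ q → ∣ image q ∣ ≡ ∣ q ∣
    image⊆  : ∀ q → image q ⊆ V
    image⁻  : ∀ q {y} → y ∈ image q → ∃ λ i → i ∈ q × embed i ≡ y

  Mono-image : ∀ c b q → Mono (pullback embed c) b q → Mono c b (image q)
  Mono-image c b q mono y y′ y∈ y′∈ y≢y′ with image⁻ q y∈ | image⁻ q y′∈
  ... | i , i∈q , refl | i′ , i′∈q , refl = mono i i′ i∈q i′∈q (y≢y′ ∘ cong embed)

embedding : ∀ {m n} (V : Subset n) → m ≤ ∣ V ∣ → Embedding m V
embedding {zero} {n} V _ = record
  { embed = λ () ; image = λ _ → ⊥ ; ∣image∣ = λ { [] → ∣⊥∣≡0 n }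
  ; image⊆ = λ _ y∈⊥ → contradiction y∈⊥ ∉⊥ ; image⁻ = λ _ y∈⊥ → contradiction y∈⊥ ∉⊥ }
embedding {m} (outside ∷ V) m≤ = record
  { embed = suc ∘ E.embed ; image = λ q → outside ∷ E.image q ; ∣image∣ = E.∣image∣
  ; image⊆ = λ { q (there y∈) → there (E.image⊆ q y∈) }
  ; image⁻ = λ { q (there y∈) → let i , i∈q , eq = E.image⁻ q y∈ in i , i∈q , cong suc eq } }
  where module E = Embedding (embedding {m} V m≤)
embedding {suc m} (inside ∷ V) (s≤s m≤) = record
  { embed = λ { zero → zero ; (suc i) → suc (E.embed i) }
  ; image = λ { (a ∷ q) → a ∷ E.image q }
  ; ∣image∣ = λ { (inside ∷ q) → cong suc (E.∣image∣ q) ; (outside ∷ q) → E.∣image∣ q }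
  ; image⊆ = λ { (a ∷ q) here → here ; (a ∷ q) (there y∈) → there (E.image⊆ q y∈) }
  ; image⁻ = λ { (a ∷ q) here → zero , here , refl
               ; (a ∷ q) (there y∈) → let i , i∈q , eq = E.image⁻ q y∈ in suc i , there i∈q , cong suc eq } }
  where module E = Embedding (embedding V m≤)

Arrows-within : ∀ {a a′ m n} → Arrows a a′ m → (c : Coloring n) (V : Subset n) → m ≤ ∣ V ∣ →
  (∃ λ q → MonoCliqueIn c true V a q) ⊎ (∃ λ q → MonoCliqueIn c false V a′ q)
Arrows-within arrows c V m≤ = Sum.map (transport true) (transport false) (arrows (pullback E.embed c))
  where
  module E = Embedding (embedding V m≤)
  transport : ∀ b {k} → HasMonoClique (pullback E.embed c) b k → ∃ λ q → MonoCliqueIn c b V k q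
  transport b (q , ∣q∣≡ , mono) = E.image q , E.image⊆ q , trans (E.∣image∣ q) ∣q∣≡ , E.Mono-image c b q mono

-- Cloning a vertex

focus : ∀ {n} → Bool → Coloring n → Coloring n
focus b c = record
  { col = λ i j → does (col c i j ≟ᵇ b) ; sym = λ i j → cong (λ x → does (x ≟ᵇ b)) (Coloring.sym c i j) }

module _ {n} (c : Coloring n) (b : Bool) {q : Subset n} where

  Mono-focus-true : Mono (focus b c) true q → Mono c b q
  Mono-focus-true mono i j i∈ j∈ i≢j with col c i j ≟ᵇ b | mono i j i∈ j∈ i≢j
  ... | yes ij≡b | _ = ij≡b

  Mono-focus-false : Mono (focus b c) false q → Mono c (not b) q
  Mono-focus-false mono i j i∈ j∈ i≢j with col c i j ≟ᵇ b | mono i j i∈ j∈ i≢j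
  ... | no ij≢b | _ = ¬-not ij≢b

NoMonoClique : ∀ {n} → Coloring n → ℕ → Set
NoMonoClique c s = ∀ b p → ∣ p ∣ ≡ s → ¬ Mono c b p

module _ {N} (c : Coloring (suc N)) where

  tailColoring : Coloring N
  tailColoring = record { col = λ i j → col c (suc i) (suc j) ; sym = λ i j → Coloring.sym c (suc i) (suc j) }

  link : Bool → Subset N
  link b = select (λ k → col c zero (suc k) ≟ᵇ b)

  ∈-link⁺ : ∀ {b k} → col c zero (suc k) ≡ b → k ∈ link b
  ∈-link⁺ {b} = ∈-select⁺ (λ k → col c zero (suc k) ≟ᵇ b)

  ∈-link⁻ : ∀ {b k} → k ∈ link b → col c zero (suc k) ≡ b
  ∈-link⁻ {b} = ∈-select⁻ (λ k → col c zero (suc k) ≟ᵇ b)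

  ∣link-true∣+∣link-false∣ : ∣ link true ∣ + ∣ link false ∣ ≡ N
  ∣link-true∣+∣link-false∣ = go (λ k → col c zero (suc k))
    where
    go : ∀ {m} (f : Fin m → Bool) → ∣ select (λ k → f k ≟ᵇ true) ∣ + ∣ select (λ k → f k ≟ᵇ false) ∣ ≡ m
    go {zero}  f = refl
    go {suc m} f with f zero
    ... | true  = cong suc (go (f ∘ suc))
    ... | false = trans (+-suc _ _) (cong suc (go (f ∘ suc)))

  Mono-outside : ∀ {b q} → Mono tailColoring b q → Mono c b (outside ∷ q)
  Mono-outside mono (suc i) (suc j) (there i∈) (there j∈) i≢j = mono i j i∈ j∈ (i≢j ∘ cong suc)

  Mono-inside : ∀ {b q} → q ⊆ link b → Mono tailColoring b q → Mono c b (inside ∷ q)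
  Mono-inside q⊆ mono zero    zero    _          _          i≢j = contradiction refl i≢j
  Mono-inside q⊆ mono zero    (suc j) _          (there j∈) _   = ∈-link⁻ (q⊆ j∈)
  Mono-inside q⊆ mono (suc i) zero    (there i∈) _          _   = trans (Coloring.sym c (suc i) zero) (∈-link⁻ (q⊆ i∈))
  Mono-inside q⊆ mono (suc i) (suc j) (there i∈) (there j∈) i≢j = mono i j i∈ j∈ (i≢j ∘ cong suc)

  module _ {r : ℕ} (noMono : NoMonoClique c (suc (suc r))) where

    link-cliqueFree : ∀ b q → ¬ MonoCliqueIn tailColoring b (link b) (suc r) q
    link-cliqueFree b q (q⊆ , ∣q∣≡ , mono) = noMono b (inside ∷ q) (cong suc ∣q∣≡) (Mono-inside q⊆ mono)

    -- A link of size at least R′ contains a K_{r+1} of its own colour, which vertex zero extends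
    -- to a K_{r+2}, or a K_{r+2} of the other colour.
    ∣link∣< : ∀ {R′} → Arrows (suc r) (suc (suc r)) R′ → ∀ b → ∣ link b ∣ < R′
    ∣link∣< {R′} arrows b = ≰⇒> λ R′≤ →
      case Arrows-within arrows (focus b tailColoring) (link b) R′≤ of λ where
        (inj₁ (q , q⊆ , ∣q∣≡ , mono)) → link-cliqueFree b q (q⊆ , ∣q∣≡ , Mono-focus-true tailColoring b mono)
        (inj₂ (q , _  , ∣q∣≡ , mono)) →
          noMono (not b) (outside ∷ q) ∣q∣≡ (Mono-outside (Mono-focus-false tailColoring b mono))

-- Vertex zero is a twin of vertex one (the old vertex zero), joined to it by an edge of colour b.
clone : ∀ {N} → Coloring (suc N) → Bool → Coloring (suc (suc N))
clone {N} c b = record { col = col′ ; sym = sym′ }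
  where
  twin : Fin (suc N) → Bool
  twin zero    = b
  twin (suc k) = col c zero (suc k)
  col′ : Fin (suc (suc N)) → Fin (suc (suc N)) → Bool
  col′ zero    zero    = b
  col′ zero    (suc j) = twin j
  col′ (suc i) zero    = twin i
  col′ (suc i) (suc j) = col c i j
  sym′ : ∀ i j → col′ i j ≡ col′ j i
  sym′ zero    zero    = refl
  sym′ zero    (suc j) = refl
  sym′ (suc i) zero    = refl
  sym′ (suc i) (suc j) = Coloring.sym c i j

MonoClique : ∀ {n} → ℕ → Coloring n → Subset n → Set
MonoClique s c p = ∣ p ∣ ≡ s × (Mono c true p ⊎ Mono c false p)

monoClique? : ∀ {n} s (c : Coloring n) → Decidable (MonoClique s c)
monoClique? s c p = (∣ p ∣ ≟ s) ×-dec (mono? c true p ⊎-dec mono? c false p)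

module _ {N} (c : Coloring (suc N)) (b : Bool) where

  Mono-clone-twins : ∀ {b′ q} → Mono (clone c b) b′ (inside ∷ inside ∷ q) → q ⊆ link c b × Mono (tailColoring c) b q
  Mono-clone-twins {b′} {q} mono =
      (λ z∈ → ∈-link⁺ c (trans (mono zero (suc (suc _)) here (there (there z∈)) (λ ())) (sym b≡b′)))
    , λ i j i∈ j∈ i≢j → trans (mono (suc (suc i)) (suc (suc j)) (there (there i∈)) (there (there j∈))
                                    (i≢j ∘ fsuc-injective ∘ fsuc-injective))
                              (sym b≡b′)
    where
    b≡b′ : b ≡ b′
    b≡b′ = mono zero (suc zero) here (there here) (λ ())

  Mono-clone-without-original : ∀ {b′ q} → Mono (clone c b) b′ (inside ∷ outside ∷ q) → Mono c b′ (inside ∷ q)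
  Mono-clone-without-original mono zero    zero    _          _          i≢j = contradiction refl i≢j
  Mono-clone-without-original mono zero    (suc j) _          (there j∈) _   =
    mono zero (suc (suc j)) here (there (there j∈)) (λ ())
  Mono-clone-without-original mono (suc i) zero    (there i∈) _          _   =
    trans (Coloring.sym c (suc i) zero) (mono zero (suc (suc i)) here (there (there i∈)) (λ ()))
  Mono-clone-without-original mono (suc i) (suc j) (there i∈) (there j∈) i≢j =
    mono (suc (suc i)) (suc (suc j)) (there (there i∈)) (there (there j∈)) (i≢j ∘ fsuc-injective)

  Mono-clone-without-twin : ∀ {b′ q} → Mono (clone c b) b′ (outside ∷ q) → Mono c b′ q
  Mono-clone-without-twin mono i j i∈ j∈ i≢j = mono (suc i) (suc j) (there i∈) (there j∈) (i≢j ∘ fsuc-injective)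

  monoCount-clone≤ : ∀ {r} → NoMonoClique c (suc (suc r)) →
    monoCount (suc (suc r)) (clone c b) ≤ balancedProduct ∣ link c b ∣ r
  monoCount-clone≤ {r} noMono = begin
    monoCount s (clone c b)                                  ≡⟨ length-filter-allSubsets (monoClique? s (clone c b)) ⟩
    count withBoth? + count withoutOriginal? + count withoutTwin?
      ≡⟨ cong₂ (λ x y → count withBoth? + x + y) (count≡0 withoutOriginal? ¬withoutOriginal) (count≡0 withoutTwin? ¬withoutTwin) ⟩
    count withBoth? + 0 + 0                                  ≡⟨ trans (+-identityʳ _) (+-identityʳ _) ⟩
    count withBoth?                                          ≤⟨ count-mono withBoth? (monoCliqueIn? (tailColoring c) b (link c b) r) withBoth⇒ ⟩
    cliqueCount (tailColoring c) b (link c b) r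
      ≤⟨ cliqueCount≤balancedProduct r (tailColoring c) b (link c b) (link-cliqueFree c noMono b) ⟩
    balancedProduct ∣ link c b ∣ r                           ∎
    where
    open ≤-Reasoning
    s = suc (suc r)
    withBoth? : Decidable (λ q → MonoClique s (clone c b) (inside ∷ inside ∷ q))
    withBoth? q = monoClique? s (clone c b) (inside ∷ inside ∷ q)
    withoutOriginal? : Decidable (λ q → MonoClique s (clone c b) (inside ∷ outside ∷ q))
    withoutOriginal? q = monoClique? s (clone c b) (inside ∷ outside ∷ q)
    withoutTwin? : Decidable (λ q → MonoClique s (clone c b) (outside ∷ q))
    withoutTwin? q = monoClique? s (clone c b) (outside ∷ q)
    withBoth⇒ : ∀ q → MonoClique s (clone c b) (inside ∷ inside ∷ q) → MonoCliqueIn (tailColoring c) b (link c b) r q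
    withBoth⇒ q (∣∣≡ , mono) =
      Product.map₂ (suc-injective (suc-injective ∣∣≡) ,_) (Sum.[ Mono-clone-twins , Mono-clone-twins ]′ mono)
    ¬withoutOriginal : ∀ q → ¬ MonoClique s (clone c b) (inside ∷ outside ∷ q)
    ¬withoutOriginal q (∣∣≡ , inj₁ mono) = noMono true  (inside ∷ q) ∣∣≡ (Mono-clone-without-original mono)
    ¬withoutOriginal q (∣∣≡ , inj₂ mono) = noMono false (inside ∷ q) ∣∣≡ (Mono-clone-without-original mono)
    ¬withoutTwin : ∀ q → ¬ MonoClique s (clone c b) (outside ∷ q)
    ¬withoutTwin q (∣∣≡ , inj₁ mono) = noMono true  q ∣∣≡ (Mono-clone-without-twin mono)
    ¬withoutTwin q (∣∣≡ , inj₂ mono) = noMono false q ∣∣≡ (Mono-clone-without-twin mono)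

≤-foldr-⊔ : ∀ {x xs} → x ∈ₗ xs → x ≤ foldr _⊔_ 0 xs
≤-foldr-⊔                (here refl) = m≤m⊔n _ _
≤-foldr-⊔ {xs = y ∷ _} (there x∈)  = ≤-trans (≤-foldr-⊔ x∈) (m≤n⊔m y _)

∈-candidatePairs : ∀ {R2 n₁ n₂} → n₁ < R2 + 3 → n₂ < R2 + 3 → (n₁ , n₂) ∈ₗ candidatePairs R2
∈-candidatePairs {R2} {n₁} {n₂} n₁< n₂< = ∈-concatMap⁺ (λ a → map (a ,_) (upTo (R2 + 3)))
  (Any.map (λ { refl → ∈-map⁺ (n₁ ,_) (∈-applyUpTo⁺ id n₂<) }) (∈-applyUpTo⁺ id n₁<))

≤-bound : ∀ {s R2 R′ n₁ n₂} → Admissible s R2 R′ n₁ n₂ → prodTerm s n₁ ⊓ prodTerm s n₂ ≤ bound s R2 R′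
≤-bound {s} {R2} {R′} {n₁} {n₂} adm@(_ , _ , n₁+n₂≤ , _) =
  ≤-foldr-⊔ (∈-map⁺ (λ { (a , b) → prodTerm s a ⊓ prodTerm s b })
    (∈-filter⁺ (λ { (a , b) → admissible? s R2 R′ a b })
      (∈-candidatePairs (<R2+3 (m≤m+n n₁ n₂)) (<R2+3 (m≤n+m n₂ n₁))) adm))
  where
  <R2+3 : ∀ {n} → n ≤ n₁ + n₂ → n < R2 + 3
  <R2+3 {n} n≤ = subst (n <_) (sym (+-suc R2 2)) (s≤s (≤-trans n≤ n₁+n₂≤))

∣m-n∣<o∸k : ∀ {m n o k} → k ≤ m → k ≤ n → m < o → n < o → ∣ m - n ∣ < o ∸ k
∣m-n∣<o∸k {m} {n} {o} {k} k≤m k≤n m<o n<o with ≤-total m n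
... | inj₁ m≤n = subst (_< o ∸ k) (sym (m≤n⇒∣m-n∣≡n∸m m≤n))
                     (≤-<-trans (∸-monoʳ-≤ n k≤m) (∸-monoˡ-< n<o k≤n))
... | inj₂ n≤m = subst (_< o ∸ k) (sym (m≤n⇒∣n-m∣≡n∸m n≤m))
                     (≤-<-trans (∸-monoʳ-≤ m k≤n) (∸-monoˡ-< m<o k≤m))

≤-bound-of-split : ∀ {r K R′ M} d₁ d₂ → d₁ + d₂ ≡ K → d₁ < R′ → d₂ < R′ →
  M ≤ balancedProduct d₁ r → M ≤ balancedProduct d₂ r → M ≤ bound (suc (suc r)) (suc (suc K)) R′
≤-bound-of-split {r} {M = M} d₁ d₂ _ _ _ M≤₁ M≤₂ with r ≤? d₁ | r ≤? d₂
... | no r≰d₁ | _       = ≤-trans (subst (M ≤_) (balancedProduct≡0 (≰⇒> r≰d₁)) M≤₁) z≤n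
... | yes _   | no r≰d₂ = ≤-trans (subst (M ≤_) (balancedProduct≡0 (≰⇒> r≰d₂)) M≤₂) z≤n
≤-bound-of-split {r} {K} {M = M} d₁ d₂ d₁+d₂≡K d₁< d₂< M≤₁ M≤₂ | yes r≤d₁ | yes r≤d₂ =
  ≤-trans (⊓-glb (subst (M ≤_) (sym (prodTerm≡balancedProduct s (2 + d₁))) M≤₁)
                 (subst (M ≤_) (sym (prodTerm≡balancedProduct s (2 + d₂))) M≤₂))
          (≤-bound {s} {suc (suc K)}
            (s≤s (s≤s r≤d₁) , s≤s (s≤s r≤d₂) , ≤-reflexive (cong (2 +_) sum≡) , ∣m-n∣<o∸k r≤d₁ r≤d₂ d₁< d₂<))
  where
  s = suc (suc r)
  sum≡ : d₁ + (2 + d₂) ≡ K + 2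
  sum≡ = trans (cong (d₁ +_) (+-comm 2 d₂)) (trans (sym (+-assoc d₁ d₂ 2)) (cong (_+ 2) d₁+d₂≡K))

≤-bound-of-NoMonoClique : ∀ {r K R′ M} (c : Coloring (suc K)) → NoMonoClique c (suc (suc r)) →
  Arrows (suc r) (suc (suc r)) R′ → (∀ (c′ : Coloring (suc (suc K))) → M ≤ monoCount (suc (suc r)) c′) →
  M ≤ bound (suc (suc r)) (suc (suc K)) R′
≤-bound-of-NoMonoClique {r} {M = M} c noMono arrows′ minimal =
  ≤-bound-of-split ∣ link c true ∣ ∣ link c false ∣ (∣link-true∣+∣link-false∣ c)
    (∣link∣< c noMono arrows′ true) (∣link∣< c noMono arrows′ false) (M≤ true) (M≤ false)
  where
  M≤ : ∀ b → M ≤ balancedProduct ∣ link c b ∣ r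
  M≤ b = ≤-trans (minimal (clone c b)) (monoCount-clone≤ c b noMono)

Arrows⇒≤ : ∀ {a m} → Arrows a a m → a ≤ m
Arrows⇒≤ {a} {m} arrows with arrows (record { col = λ _ _ → true ; sym = λ _ _ → refl })
... | inj₁ (p , ∣p∣≡a , _) = subst (_≤ m) ∣p∣≡a (∣p∣≤n p)
... | inj₂ (p , ∣p∣≡a , _) = subst (_≤ m) ∣p∣≡a (∣p∣≤n p)

IsRamsey-unique : ∀ {a b m n} → IsRamsey a b m → IsRamsey a b n → m ≡ n
IsRamsey-unique (arrows-m , least-m) (arrows-n , least-n) = ≤-antisym (least-m _ arrows-n) (least-n _ arrows-m)

hasMonoClique? : ∀ {n} (c : Coloring n) b a → Dec (HasMonoClique c b a)
hasMonoClique? c b a = anySubset? (λ p → (∣ p ∣ ≟ a) ×-dec mono? c b p)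

-- A colouring of K_{R(s,s) − 1} without monochromatic K_s exists by minimality; only its
-- existence is used, so the decidable goal may be proved by contradiction.
critical≤bound : ∀ r {R2 R′ M} → IsRamsey (suc (suc r)) (suc (suc r)) R2 → Arrows (suc r) (suc (suc r)) R′ →
  (∀ (c : Coloring R2) → M ≤ monoCount (suc (suc r)) c) → M ≤ bound (suc (suc r)) R2 R′
critical≤bound r {R2} {R′} {M} (arrows , least) arrows′ minimal with Arrows⇒≤ arrows
... | s≤s (s≤s {n = K} _) = decidable-stable (M ≤? bound s (suc (suc K)) R′) λ M≰bound →
  1+n≰n (least (suc K) λ c → case hasMonoClique? c true s ⊎-dec hasMonoClique? c false s of λ where
    (yes mono) → mono
    (no ¬mono) → contradiction (≤-bound-of-NoMonoClique c (noMono {c} ¬mono) arrows′ minimal) M≰bound)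
  where
  s = suc (suc r)
  noMono : ∀ {c : Coloring (suc K)} → ¬ (HasMonoClique c true s ⊎ HasMonoClique c false s) → NoMonoClique c s
  noMono ¬mono true  p ∣p∣≡s mono = ¬mono (inj₁ (p , ∣p∣≡s , mono))
  noMono ¬mono false p ∣p∣≡s mono = ¬mono (inj₂ (p , ∣p∣≡s , mono))

theorem3p4 : (s : ℕ) → 3 ≤ s → (R2 R' M : ℕ) →
    IsRamsey s s R2 → IsRamsey (s ∸ 1) s R' → IsCriticalMultiplicity s M →
    M ≤ bound s R2 R'
theorem3p4 (suc (suc r)) (s≤s (s≤s _)) R2 R' M ramsey ramsey′ (N , ramseyN , minimal , _) =
  critical≤bound r ramsey (proj₁ ramsey′)
    (subst (λ n → ∀ (c : Coloring n) → M ≤ monoCount (suc (suc r)) c) (IsRamsey-unique ramseyN ramsey) minimal)
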